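{- Let $n\ge k\ge1$ and let $p,q\in\phi(n,k)$ be two major motifs. If $p[1]>q[1]$, then $p\succeq q$.
   Context: A motif of $n$ is a finite non-increasing sequence $p=(p[1],\dots,p[k])$ of positive integers with sum $n$; $\phi(n,k)$ is the set of motifs of $n$ of length $k$. For motifs $p,q$ of $n$, $p\succeq q$ means $\sum_{x=1}^t p[x]\ge\sum_{x=1}^t q[x]$ for every $1\le t\le\min(|p|,|q|)$. A motif $p\in\phi(n,k)$ is major if there is an integer $\lambda$ with $\lceil n/k\rceil\le\lambda\le n-k+1$ and $\lambda\ge2$ such that, writing $\beta=\lfloor (n-k)/(\lambda-1)\rfloor$, one has $p[x]=\lambda$ for $1\le x\le\beta$, $p[\beta+1]=n-\beta\lambda-(k-\beta-1)$ (when $\beta+1\le k$), and $p[x]=1$ for $\beta+1<x\le k$. -}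

module Defs where

open import Data.Nat using (ℕ; zero; suc; _+_; _*_; _∸_; _≤_; _<_; _≥_; _>_; NonZero; _⊓_)
open import Data.Nat.DivMod using (_/_)
open import Data.List using (List; []; _∷_; length; take)
open import Data.Nat.ListAction using (sum)
open import Data.List.Relation.Unary.All using (All)
open import Data.List.Relation.Unary.Linked using (Linked)
open import Data.Product using (Σ; ∃; _×_)
open import Relation.Binary.PropositionalEquality using (_≡_)

-- 1-indexed lookup: p [ 1 ] is the first entry; out-of-range gives 0.
_[_] : List ℕ → ℕ → ℕ
[] [ _ ] = 0
(a ∷ p) [ zero ] = 0
(a ∷ p) [ suc zero ] = a
(a ∷ p) [ suc (suc x) ] = p [ suc x ]

record IsMotif (n k : ℕ) (p : List ℕ) : Set where
  field
    len      : length p ≡ k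
    positive : All (λ a → 1 ≤ a) p
    nonIncr  : Linked _≥_ p
    total    : sum p ≡ n

_⪰_ : List ℕ → List ℕ → Set
p ⪰ q = ∀ t → 1 ≤ t → t ≤ length p ⊓ length q → sum (take t q) ≤ sum (take t p)

⌈_/_⌉ : (n k : ℕ) → .{{NonZero k}} → ℕ
⌈ n / k ⌉ = (n + (k ∸ 1)) / k

Major : (n k : ℕ) → .{{NonZero k}} → List ℕ → Set
Major n k p =
  Σ ℕ λ l →
    (⌈ n / k ⌉ ≤ l) × (l ≤ n ∸ k + 1) × (2 ≤ l) ×
    (-- since 2 ≤ l, suc (l ∸ 2) = l - 1 (written this way to make the divisor visibly nonzero)
     let β = (n ∸ k) / suc (l ∸ 2) in
      (∀ x → 1 ≤ x → x ≤ β → p [ x ] ≡ l) ×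
      (β + 1 ≤ k → p [ β + 1 ] ≡ n ∸ β * l ∸ (k ∸ β ∸ 1)) ×
      (∀ x → β + 1 < x → x ≤ k → p [ x ] ≡ 1))

module Submission where

-- Let p be major with plateau height l and plateau length β, so
-- p = (l,…,l, r, 1,…,1) with β copies of l; only the shape of p matters, q
-- merely has to be a motif of n of length k with q[1] < p[1].  Fix a prefix
-- length 1 ≤ t ≤ k and compare the prefix sums in two regimes.
--   * t ≤ β: the prefix of p is the plateau, of sum t·l; since q is
--     non-increasing, each of its first t entries is at most q[1] < p[1] = l.
--   * β < t: every entry of p after position t is 1, so the suffix of p sums to
--     its length k − t, while the suffix of q, consisting of positive entries,
--     sums to at least k − t; as both motifs have total n, the prefix of p
--     dominates that of q.

open import Defs
open import Data.Nat using (ℕ; NonZero; _≤_; _>_; _<_; _≥_; zero; suc; _+_; _*_; _∸_; _⊓_; z≤n; s≤s)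
open import Data.Nat.Properties
open import Data.List using (List; []; _∷_; take; drop; length)
open import Data.List.Properties using (length-drop; length-take; take++drop≡id)
open import Data.Nat.ListAction using (sum)
open import Data.Nat.ListAction.Properties using (sum-++)
open import Data.List.Relation.Unary.All using (All; []; _∷_)
open import Data.List.Relation.Unary.All.Properties using (take⁺; drop⁺)
open import Data.List.Relation.Unary.Linked using (Linked; []; [-]; _∷_)
open import Data.Product using (_,_)
open import Relation.Binary.PropositionalEquality using (_≡_; refl; sym; trans; cong; cong₂; subst)
open import Relation.Nullary using (yes; no)

index-tail : ∀ a (xs : List ℕ) x → 1 ≤ x → (a ∷ xs) [ suc x ] ≡ xs [ x ]
index-tail a xs (suc x) _ = refl

index-drop : ∀ t (xs : List ℕ) x → 1 ≤ x → drop t xs [ x ] ≡ xs [ t + x ]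
index-drop zero    xs       x _   = refl
index-drop (suc t) []       x _   = refl
index-drop (suc t) (a ∷ xs) x 1≤x =
  trans (index-drop t xs x 1≤x) (sym (index-tail a xs (t + x) (≤-trans 1≤x (m≤n+m x t))))

all-from-index : ∀ {P : ℕ → Set} (xs : List ℕ) →
  (∀ x → 1 ≤ x → x ≤ length xs → P (xs [ x ])) → All P xs
all-from-index []       _ = []
all-from-index {P} (a ∷ xs) h =
  h 1 ≤-refl (s≤s z≤n) ∷
  all-from-index xs (λ x 1≤x x≤len →
    subst P (index-tail a xs x 1≤x) (h (suc x) (s≤s z≤n) (s≤s x≤len)))

nonIncreasing-bounded : ∀ {b} (xs : List ℕ) → Linked _≥_ xs → xs [ 1 ] ≤ b → All (_≤ b) xs
nonIncreasing-bounded []           []         _   = []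
nonIncreasing-bounded (a ∷ [])     [-]        a≤b = a≤b ∷ []
nonIncreasing-bounded (a ∷ c ∷ xs) (c≤a ∷ lk) a≤b =
  a≤b ∷ nonIncreasing-bounded (c ∷ xs) lk (≤-trans c≤a a≤b)

sum-≤-length* : ∀ {c} (xs : List ℕ) → All (_≤ c) xs → sum xs ≤ length xs * c
sum-≤-length* []       []         = z≤n
sum-≤-length* (a ∷ xs) (a≤c ∷ hs) = +-mono-≤ a≤c (sum-≤-length* xs hs)

length-≤-sum : (xs : List ℕ) → All (1 ≤_) xs → length xs ≤ sum xs
length-≤-sum []       []         = z≤n
length-≤-sum (a ∷ xs) (1≤a ∷ hs) = +-mono-≤ 1≤a (length-≤-sum xs hs)

sum-take-bounded : ∀ {b} t (xs : List ℕ) → All (_≤ b) xs → sum (take t xs) ≤ t * b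
sum-take-bounded {b} t xs h = begin
  sum (take t xs)           ≤⟨ sum-≤-length* (take t xs) (take⁺ t h) ⟩
  length (take t xs) * b    ≡⟨ cong (_* b) (length-take t xs) ⟩
  (t ⊓ length xs) * b       ≤⟨ *-monoˡ-≤ b (m⊓n≤m t (length xs)) ⟩
  t * b                     ∎
  where open ≤-Reasoning

sum-take-plateau : ∀ {l} m (xs : List ℕ) → m ≤ length xs →
  (∀ x → 1 ≤ x → x ≤ m → xs [ x ] ≡ l) → sum (take m xs) ≡ m * l
sum-take-plateau zero    xs       _          _ = refl
sum-take-plateau (suc m) (a ∷ xs) (s≤s m≤len) h =
  cong₂ _+_ (h 1 ≤-refl (s≤s z≤n))
    (sum-take-plateau m xs m≤len (λ x 1≤x x≤m →
      trans (sym (index-tail a xs x 1≤x)) (h (suc x) (s≤s z≤n) (s≤s x≤m))))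

sum-take-drop : ∀ t (xs : List ℕ) → sum (take t xs) + sum (drop t xs) ≡ sum xs
sum-take-drop t xs = trans (sym (sum-++ (take t xs) (drop t xs))) (cong sum (take++drop≡id t xs))

prefix-from-suffix : ∀ t (xs ys : List ℕ) → sum xs ≡ sum ys →
  sum (drop t xs) ≤ sum (drop t ys) → sum (take t ys) ≤ sum (take t xs)
prefix-from-suffix t xs ys same-total suffix≤ =
  +-cancelʳ-≤ (sum (drop t ys)) (sum (take t ys)) (sum (take t xs)) (begin
    sum (take t ys) + sum (drop t ys) ≡⟨ sum-take-drop t ys ⟩
    sum ys                            ≡⟨ sym same-total ⟩
    sum xs                            ≡⟨ sym (sum-take-drop t xs) ⟩
    sum (take t xs) + sum (drop t xs) ≤⟨ +-monoʳ-≤ (sum (take t xs)) suffix≤ ⟩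
    sum (take t xs) + sum (drop t ys) ∎)
  where open ≤-Reasoning

plateau-regime : ∀ {l β} t (p q : List ℕ) → 1 ≤ t → t ≤ β → t ≤ length p →
  (∀ x → 1 ≤ x → x ≤ β → p [ x ] ≡ l) → Linked _≥_ q → p [ 1 ] > q [ 1 ] →
  sum (take t q) ≤ sum (take t p)
plateau-regime {l} t p q 1≤t t≤β t≤len plateau q-nonIncr p₁>q₁ = begin
  sum (take t q) ≤⟨ sum-take-bounded t q (nonIncreasing-bounded q q-nonIncr q₁≤l) ⟩
  t * l          ≡⟨ sym (sum-take-plateau t p t≤len (λ x 1≤x x≤t → plateau x 1≤x (≤-trans x≤t t≤β))) ⟩
  sum (take t p) ∎
  where
  open ≤-Reasoning
  q₁≤l : q [ 1 ] ≤ l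
  q₁≤l = <⇒≤ (subst (q [ 1 ] <_) (plateau 1 ≤-refl (≤-trans 1≤t t≤β)) p₁>q₁)

tail-regime : ∀ {n k β} t (p q : List ℕ) → IsMotif n k p → IsMotif n k q → β < t → t ≤ k →
  (∀ x → β + 1 < x → x ≤ k → p [ x ] ≡ 1) → sum (take t q) ≤ sum (take t p)
tail-regime {k = k} t p q mp mq β<t t≤k ones =
  prefix-from-suffix t p q (trans (IsMotif.total mp) (sym (IsMotif.total mq))) (begin
    sum (drop t p)            ≤⟨ sum-≤-length* (drop t p) suffix-ones ⟩
    length (drop t p) * 1     ≡⟨ *-identityʳ _ ⟩
    length (drop t p)         ≡⟨ same-length ⟩
    length (drop t q)         ≤⟨ length-≤-sum (drop t q) (drop⁺ t (IsMotif.positive mq)) ⟩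
    sum (drop t q)            ∎)
  where
  open ≤-Reasoning
  suffix-length : length (drop t p) ≡ k ∸ t
  suffix-length = trans (length-drop t p) (cong (_∸ t) (IsMotif.len mp))
  same-length : length (drop t p) ≡ length (drop t q)
  same-length = trans suffix-length
    (sym (trans (length-drop t q) (cong (_∸ t) (IsMotif.len mq))))
  suffix-ones : All (_≤ 1) (drop t p)
  suffix-ones = all-from-index (drop t p) (λ x 1≤x x≤len → ≤-reflexive (begin-equality
    drop t p [ x ] ≡⟨ index-drop t p x 1≤x ⟩
    p [ t + x ]    ≡⟨ ones (t + x) (+-mono-≤ β<t 1≤x)
                      (subst (_≤ k) (+-comm x t)
                        (m≤o∸n⇒m+n≤o x t≤k (subst (x ≤_) suffix-length x≤len))) ⟩
    1              ∎))

plateau-then-ones⇒⪰ : ∀ {n k l β} (p q : List ℕ) → IsMotif n k p → IsMotif n k q →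
  (∀ x → 1 ≤ x → x ≤ β → p [ x ] ≡ l) → (∀ x → β + 1 < x → x ≤ k → p [ x ] ≡ 1) →
  p [ 1 ] > q [ 1 ] → p ⪰ q
plateau-then-ones⇒⪰ {k = k} {β = β} p q mp mq plateau ones p₁>q₁ t 1≤t t≤min with t ≤? β
... | yes t≤β = plateau-regime t p q 1≤t t≤β t≤len-p plateau (IsMotif.nonIncr mq) p₁>q₁
  where
  t≤len-p : t ≤ length p
  t≤len-p = ≤-trans t≤min (m⊓n≤m (length p) (length q))
... | no t≰β = tail-regime t p q mp mq (≰⇒> t≰β) t≤k ones
  where
  t≤k : t ≤ k
  t≤k = subst (t ≤_) (IsMotif.len mp) (≤-trans t≤min (m⊓n≤m (length p) (length q)))

-- Theorem 8: a major motif with the larger first part dominates.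
mainTheorem8 : (n k : ℕ) → .{{_ : NonZero k}} → 1 ≤ k → k ≤ n → (p q : List ℕ) →
    IsMotif n k p → IsMotif n k q → Major n k p → Major n k q →
    p [ 1 ] > q [ 1 ] → p ⪰ q
mainTheorem8 n k _ _ p q mp mq (_ , _ , _ , _ , plateau , _ , ones) _ p₁>q₁ =
  plateau-then-ones⇒⪰ p q mp mq plateau ones p₁>q₁
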